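{- Let $G$ be a finite simple connected graph and let $k\ge 0$ be an integer. Then $\mu_k(G)\ge gp(G)$ and $\mu_k(G)\ge \Delta(G)$. Moreover, if $k\ge 1$, then $\mu_k(G)\ge \Delta(G)+1$.
   Context: $\Delta(G)$ is the maximum degree of $G$. A set $S\subseteq V(G)$ is in general position if no vertex of $S$ lies on a shortest path between two other vertices of $S$; $gp(G)$ is the maximum cardinality of a general position set. For $X\subseteq V(G)$, two vertices $u,v$ are $(X,k)$-visible if there exists a shortest $(u,v)$-path in $G$ having at most $k$ internal vertices in $X$. $X$ is a mutual $k$-visible set if every pair of distinct vertices of $X$ is $(X,k)$-visible; $\mu_k(G)$ is the maximum cardinality of a mutual $k$-visible set. -}

module Defs where

open import Data.Nat using (ℕ; zero; suc; _≤_; _<_)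
open import Data.Fin using (Fin)
open import Data.Fin.Subset using (Subset; _∈_; _∉_; ∣_∣)
open import Data.Fin.Subset.Properties using (_∈?_)
open import Data.Bool using (Bool; T)
open import Data.List using (List; []; _∷_; filter; length)
open import Data.List.Membership.Propositional renaming (_∈_ to _∈L_)
open import Data.Product using (Σ; ∃; _×_; _,_)
open import Data.Vec using (tabulate)
open import Relation.Nullary using (¬_)
open import Relation.Binary.PropositionalEquality using (_≡_; _≢_)

record Graph (n : ℕ) : Set where
  field
    adj   : Fin n → Fin n → Bool
    sym   : ∀ u v → adj u v ≡ adj v u
    irrefl : ∀ u → ¬ T (adj u u)

module _ {n : ℕ} (G : Graph n) where
  open Graph G

  Adj : Fin n → Fin n → Set
  Adj u v = T (adj u v)

  data Walk : Fin n → Fin n → ℕ → Set where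
    []  : ∀ {u} → Walk u u 0
    _∷_ : ∀ {u w v l} → Adj u w → Walk w v l → Walk u v (suc l)

  internal : ∀ {u v l} → Walk u v l → List (Fin n)
  internal [] = []
  internal (_ ∷ []) = []
  internal (_∷_ {w = w} _ p@(_ ∷ _)) = w ∷ internal p

  IsShortest : ∀ {u v l} → Walk u v l → Set
  IsShortest {u} {v} {l} _ = ∀ {l'} → Walk u v l' → ¬ (l' < l)

  Connected : Set
  Connected = ∀ u v → ∃ λ l → Walk u v l

  degree : Fin n → ℕ
  degree v = ∣ tabulate (adj v) ∣

  IsGeneralPosition : Subset n → Set
  IsGeneralPosition S =
    ∀ {u v w l} → u ∈ S → v ∈ S → w ∈ S → u ≢ v → w ≢ u → w ≢ v →
      (p : Walk u v l) → IsShortest p → ¬ (w ∈L internal p)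

  countIn : Subset n → ∀ {u v l} → Walk u v l → ℕ
  countIn X p = length (filter (_∈? X) (internal p))

  Visible : Subset n → ℕ → Fin n → Fin n → Set
  Visible X k u v = Σ ℕ λ l → Σ (Walk u v l) λ p → IsShortest p × countIn X p ≤ k

  IsMutualVisible : ℕ → Subset n → Set
  IsMutualVisible k X = ∀ {u v} → u ∈ X → v ∈ X → u ≢ v → Visible X k u v

{-# OPTIONS --safe #-}
-- A general position set S is itself mutual-visible: a shortest path between two
-- of its vertices has no internal vertex in S, since it cannot pass through its
-- own ends.  Any two neighbours of v are adjacent or joined by the shortest path
-- through v; as v ∉ N(v), the open neighbourhood N(v) is mutual 0-visible, and the
-- closed neighbourhood N[v], of size Δ + 1, is mutual 1-visible.
module Submission where

open import Defs
open import Data.Nat using (ℕ; zero; suc; _≤_; _<_; z≤n; s≤s)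
open import Data.Nat.Properties using (≤-refl; m<n⇒m<1+n; anyUpTo?)
open import Data.Nat.Induction using (<-rec)
open import Data.Fin using (Fin; _≟_)
open import Data.Fin.Properties using (any?)
open import Data.Fin.Subset using (Subset; ∣_∣; _∪_; ⁅_⁆; _∈_; _∉_)
open import Data.Fin.Subset.Properties
  using (_∈?_; x∈p∪q⁻; x∈p∪q⁺; x∈⁅x⁆; x∈⁅y⁆⇒x≡y; p⊂q⇒∣p∣<∣q∣; p⊆p∪q)
open import Data.Product using (∃; ∃₂; Σ; _×_; _,_)
open import Data.Sum using (_⊎_; inj₁; inj₂)
open import Data.Bool using (T)
open import Data.Bool.Properties using (T-≡)
open import Data.List using ([]; _∷_; filter; length)
open import Data.List.Properties using (filter-none)
open import Data.List.Relation.Unary.All using (tabulate)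
open import Data.List.Relation.Unary.Any using (here; there)
open import Data.List.Membership.Propositional using () renaming (_∈_ to _∈L_)
open import Data.Vec using () renaming (tabulate to tabulateᵛ)
open import Data.Vec.Properties using ([]=⇒lookup; lookup∘tabulate)
open import Data.Empty using (⊥-elim)
open import Function using (const)
open import Function.Bundles using (Equivalence)
open import Relation.Nullary using (Dec; yes; no)
open import Relation.Nullary.Decidable using (T?; _×-dec_)
open import Relation.Binary.PropositionalEquality using (_≡_; _≢_; refl; sym; trans; cong; subst)

module _ {n : ℕ} (G : Graph n) where
  open Graph G using (adj; irrefl) renaming (sym to adj-sym)

  adj? : ∀ u v → Dec (Adj G u v)
  adj? u v = T? (adj u v)

  Adj-sym : ∀ {u v} → Adj G u v → Adj G v u
  Adj-sym {u} {v} = subst T (adj-sym u v)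

  walk? : ∀ l u v → Dec (Walk G u v l)
  walk? zero u v with u ≟ v
  ... | yes refl = yes []
  ... | no u≢v = no λ { [] → u≢v refl }
  walk? (suc l) u v with any? (λ w → adj? u w ×-dec walk? l w v)
  ... | yes (_ , e , p) = yes (e ∷ p)
  ... | no ∄ = no λ { (e ∷ p) → ∄ (_ , e , p) }

  ShortestWalk : Fin n → Fin n → Set
  ShortestWalk u v = ∃ λ l → Σ (Walk G u v l) (IsShortest G)

  walk⇒shortestWalk : ∀ {u v} l → Walk G u v l → ShortestWalk u v
  walk⇒shortestWalk {u} {v} = <-rec (λ l → Walk G u v l → ShortestWalk u v) shorten
    where
    shorten : ∀ l → (∀ {m} → m < l → Walk G u v m → ShortestWalk u v) →
              Walk G u v l → ShortestWalk u v
    shorten l rec p with anyUpTo? (λ m → walk? m u v) l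
    ... | yes (m , m<l , q) = rec m<l q
    ... | no ∄ = l , p , λ q l'<l → ∄ (_ , l'<l , q)

  connected⇒shortestWalk : Connected G → ∀ u v → ShortestWalk u v
  connected⇒shortestWalk conn u v = let l , p = conn u v in walk⇒shortestWalk l p

  internal⇒shorterWalks : ∀ {u v w l} (p : Walk G u v l) → w ∈L internal G p →
    ∃₂ λ a b → (Walk G u w a × a < l) × (Walk G w v b × b < l)
  internal⇒shorterWalks (e ∷ (f ∷ p)) (here refl) =
    1 , _ , (e ∷ [] , s≤s (s≤s z≤n)) , (f ∷ p , ≤-refl)
  internal⇒shorterWalks (e ∷ p@(_ ∷ _)) (there w∈p) with internal⇒shorterWalks p w∈p
  ... | _ , _ , (q , a<l) , (r , b<l) = _ , _ , (e ∷ q , s≤s a<l) , (r , m<n⇒m<1+n b<l)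

  shortest⇒ends∉internal : ∀ {u v w l} (p : Walk G u v l) → IsShortest G p →
    w ∈L internal G p → w ≢ u × w ≢ v
  shortest⇒ends∉internal p shortest w∈p with internal⇒shorterWalks p w∈p
  ... | _ , _ , (q , a<l) , (r , b<l) =
    (λ { refl → shortest r b<l }) , (λ { refl → shortest q a<l })

  generalPosition⇒countIn≡0 : ∀ {S u v l} → IsGeneralPosition G S → u ∈ S → v ∈ S → u ≢ v →
    (p : Walk G u v l) → IsShortest G p → countIn G S p ≡ 0
  generalPosition⇒countIn≡0 {S} gp u∈S v∈S u≢v p shortest =
    cong length (filter-none (_∈? S) (tabulate λ w∈p w∈S →
      let w≢u , w≢v = shortest⇒ends∉internal p shortest w∈p
      in gp u∈S v∈S w∈S u≢v w≢u w≢v p shortest w∈p))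

  generalPosition⇒mutualVisible : Connected G → ∀ {S} → IsGeneralPosition G S →
    ∀ k → IsMutualVisible G k S
  generalPosition⇒mutualVisible conn gp k {u} {v} u∈S v∈S u≢v =
    let l , p , shortest = connected⇒shortestWalk conn u v
        count≡0 = generalPosition⇒countIn≡0 gp u∈S v∈S u≢v p shortest
    in l , p , shortest , subst (_≤ k) (sym count≡0) z≤n

  adjacent⇒visible : ∀ {X k u v} → u ≢ v → Adj G u v → Visible G X k u v
  adjacent⇒visible u≢v e = 1 , e ∷ [] , (λ { [] (s≤s z≤n) → u≢v refl }) , z≤n

  commonNeighbour⇒visible : ∀ {X k u v w} → u ≢ w → Adj G u v → Adj G v w →
    (v ∈ X → 1 ≤ k) → Visible G X k u w
  commonNeighbour⇒visible {X} {k} {u} {v} {w} u≢w e f v∈X⇒1≤k with adj? u w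
  ... | yes uw = adjacent⇒visible u≢w uw
  ... | no ¬uw = 2 , e ∷ f ∷ [] , shortest , count≤k
    where
    shortest : IsShortest G (e ∷ f ∷ [])
    shortest [] _ = u≢w refl
    shortest (uw ∷ []) _ = ¬uw uw
    shortest (_ ∷ _ ∷ _) (s≤s (s≤s ()))

    count≤k : length (filter (_∈? X) (v ∷ [])) ≤ k
    count≤k with v ∈? X
    ... | yes v∈X = v∈X⇒1≤k v∈X
    ... | no _ = z≤n

  neighbourhood : Fin n → Subset n
  neighbourhood v = tabulateᵛ (adj v)

  closedNeighbourhood : Fin n → Subset n
  closedNeighbourhood v = neighbourhood v ∪ ⁅ v ⁆

  ∈-neighbourhood⁻ : ∀ {u v} → u ∈ neighbourhood v → Adj G v u
  ∈-neighbourhood⁻ {u} {v} u∈N =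
    Equivalence.from T-≡ (trans (sym (lookup∘tabulate (adj v) u)) ([]=⇒lookup u∈N))

  v∉neighbourhood : ∀ v → v ∉ neighbourhood v
  v∉neighbourhood v v∈N = irrefl v (∈-neighbourhood⁻ v∈N)

  ∈-closedNeighbourhood⁻ : ∀ {u v} → u ∈ closedNeighbourhood v → Adj G v u ⊎ u ≡ v
  ∈-closedNeighbourhood⁻ {u} {v} u∈N[v] with x∈p∪q⁻ (neighbourhood v) ⁅ v ⁆ u∈N[v]
  ... | inj₁ u∈N = inj₁ (∈-neighbourhood⁻ u∈N)
  ... | inj₂ u∈⁅v⁆ = inj₂ (x∈⁅y⁆⇒x≡y v u∈⁅v⁆)

  ∣neighbourhood∣<∣closedNeighbourhood∣ : ∀ v → ∣ neighbourhood v ∣ < ∣ closedNeighbourhood v ∣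
  ∣neighbourhood∣<∣closedNeighbourhood∣ v =
    p⊂q⇒∣p∣<∣q∣ (p⊆p∪q ⁅ v ⁆ , v , x∈p∪q⁺ (inj₂ (x∈⁅x⁆ v)) , v∉neighbourhood v)

  neighbourhood-mutualVisible : ∀ k v → IsMutualVisible G k (neighbourhood v)
  neighbourhood-mutualVisible k v u∈N w∈N u≢w =
    commonNeighbour⇒visible u≢w (Adj-sym (∈-neighbourhood⁻ u∈N)) (∈-neighbourhood⁻ w∈N)
      (λ v∈N → ⊥-elim (v∉neighbourhood v v∈N))

  closedNeighbourhood-mutualVisible : ∀ {k} → 1 ≤ k → ∀ v →
    IsMutualVisible G k (closedNeighbourhood v)
  closedNeighbourhood-mutualVisible 1≤k v u∈N[v] w∈N[v] u≢w
    with ∈-closedNeighbourhood⁻ u∈N[v] | ∈-closedNeighbourhood⁻ w∈N[v]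
  ... | inj₂ refl | inj₂ refl = ⊥-elim (u≢w refl)
  ... | inj₂ refl | inj₁ vw = adjacent⇒visible u≢w vw
  ... | inj₁ vu | inj₂ refl = adjacent⇒visible u≢w (Adj-sym vu)
  ... | inj₁ vu | inj₁ vw = commonNeighbour⇒visible u≢w (Adj-sym vu) vw (const 1≤k)

proposition3p6 : ∀ {n} (G : Graph n) → Connected G → (k : ℕ) →
    ((S : Subset n) → IsGeneralPosition G S →
      ∃ λ X → IsMutualVisible G k X × ∣ S ∣ ≤ ∣ X ∣)
    × ((v : Fin n) → ∃ λ X → IsMutualVisible G k X × degree G v ≤ ∣ X ∣)
    × (1 ≤ k → (v : Fin n) → ∃ λ X → IsMutualVisible G k X × suc (degree G v) ≤ ∣ X ∣)
proposition3p6 G conn k =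
    (λ S gp → S , generalPosition⇒mutualVisible G conn gp k , ≤-refl)
  , (λ v → neighbourhood G v , neighbourhood-mutualVisible G k v , ≤-refl)
  , (λ 1≤k v → closedNeighbourhood G v , closedNeighbourhood-mutualVisible G 1≤k v
             , ∣neighbourhood∣<∣closedNeighbourhood∣ G v)
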